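{- Let $G_1$ and $G_2$ be connected graphs with $2\le \gamma(G_1)\le \gamma(G_2)$. Then $\zeta(G_1\vee G_2)\ge |V(G_1)|\cdot |V(G_2)|$.
   Context: All graphs are finite and simple. For a graph $G=(V,E)$, a set $S\subseteq V$ is a dominating set if every vertex of $V\setminus S$ is adjacent to some vertex of $S$. The domination number $\gamma(G)$ is the minimum cardinality of a dominating set; a dominating set of cardinality $\gamma(G)$ is called a $\gamma$-set. The dominion $\zeta(G)$ is the number of $\gamma$-sets of $G$. The join $G_1\vee G_2$ is the graph obtained from the disjoint union of $G_1$ and $G_2$ by adding all edges between $V(G_1)$ and $V(G_2)$. -}

module Defs where

open import Data.Nat using (ℕ; zero; suc; _+_; _⊔_; _⊓_)
open import Data.Bool using (Bool; true; false; _∧_; _∨_; not; T)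
open import Data.Fin using (Fin; zero; suc; _↑ˡ_; _↑ʳ_; splitAt)
open import Data.Fin.Subset using (Subset; _∈_; ∣_∣)
open import Data.Vec using (Vec; []; _∷_; lookup)
open import Data.List using (List; []; _∷_; map; _++_; filter; length; foldr)
open import Data.Sum using (_⊎_; inj₁; inj₂)
open import Data.Product using (Σ; ∃; _×_; _,_)
open import Relation.Binary.PropositionalEquality using (_≡_; refl)
open import Relation.Nullary using (¬_; ¬?; does)
open import Relation.Nullary.Decidable using (T?; _→-dec_)
open import Data.Fin.Subset.Properties using (_∈?_)
open import Data.Nat using (_≟_)
open import Data.Bool using (if_then_else_)
open import Relation.Nullary.Decidable using (Dec; yes; no; _×-dec_)
import Data.Fin.Properties as FinP

record Graph : Set where
  field
    n     : ℕ
    adj   : Fin n → Fin n → Bool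
    sym   : ∀ u v → adj u v ≡ adj v u
    irrefl : ∀ v → adj v v ≡ false
open Graph public

order : Graph → ℕ
order G = n G

data Walk (G : Graph) : Fin (n G) → Fin (n G) → Set where
  here : ∀ {u} → Walk G u u
  step : ∀ {u v w} → T (adj G u v) → Walk G v w → Walk G u w

Connected : Graph → Set
Connected G = ∀ u v → Walk G u v

Dominating : (G : Graph) → Subset (n G) → Set
Dominating G S = ∀ v → ¬ (v ∈ S) → ∃ λ u → u ∈ S × T (adj G v u)

Dominating? : (G : Graph) → (S : Subset (n G)) → Dec (Dominating G S)
Dominating? G S =
  FinP.all? (λ v → ¬? (v ∈? S) →-dec
                   FinP.any? (λ u → (u ∈? S) ×-dec T? (adj G v u)))

-- All subsets of Fin m (each exactly once)
allSubsets : ∀ m → List (Subset m)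
allSubsets zero    = [] ∷ []
allSubsets (suc m) = map (false ∷_) (allSubsets m) ++ map (true ∷_) (allSubsets m)


-- Domination number: minimum cardinality of a dominating set
-- (the full vertex set is dominating, so n G is a valid starting bound).
γ : Graph → ℕ
γ G = foldr (λ S k → if does (Dominating? G S) then ∣ S ∣ ⊓ k else k) (n G) (allSubsets (n G))

IsγSet : (G : Graph) → Subset (n G) → Set
IsγSet G S = Dominating G S × ∣ S ∣ ≡ γ G

IsγSet? : (G : Graph) → (S : Subset (n G)) → Dec (IsγSet G S)
IsγSet? G S = Dominating? G S ×-dec (∣ S ∣ ≟ γ G)

ζ : Graph → ℕ
ζ G = length (filter (IsγSet? G) (allSubsets (n G)))

joinAdj : (G₁ G₂ : Graph) → Fin (n G₁ + n G₂) → Fin (n G₁ + n G₂) → Bool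
joinAdj G₁ G₂ x y with splitAt (n G₁) x | splitAt (n G₁) y
... | inj₁ a | inj₁ b = adj G₁ a b
... | inj₂ a | inj₂ b = adj G₂ a b
... | inj₁ _ | inj₂ _ = true
... | inj₂ _ | inj₁ _ = true

joinSym : ∀ G₁ G₂ u v → joinAdj G₁ G₂ u v ≡ joinAdj G₁ G₂ v u
joinSym G₁ G₂ u v with splitAt (n G₁) u | splitAt (n G₁) v
... | inj₁ a | inj₁ b = Graph.sym G₁ a b
... | inj₂ a | inj₂ b = Graph.sym G₂ a b
... | inj₁ _ | inj₂ _ = refl
... | inj₂ _ | inj₁ _ = refl

joinIrrefl : ∀ G₁ G₂ v → joinAdj G₁ G₂ v v ≡ false
joinIrrefl G₁ G₂ v with splitAt (n G₁) v
... | inj₁ a = irrefl G₁ a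
... | inj₂ a = irrefl G₂ a

_∨ᴳ_ : Graph → Graph → Graph
G₁ ∨ᴳ G₂ = record { n = n G₁ + n G₂ ; adj = joinAdj G₁ G₂
                  ; sym = joinSym G₁ G₂ ; irrefl = joinIrrefl G₁ G₂ }

-- If neither G₁ nor G₂ has a dominating vertex, neither has G₁ ∨ G₂: a dominating set of the join
-- lying inside one factor dominates that factor. On the other hand any a ∈ V(G₁) and b ∈ V(G₂)
-- together dominate the join. Hence γ(G₁ ∨ G₂) = 2, and the |V(G₁)| · |V(G₂)| sets {a, b}
-- are pairwise distinct γ-sets.
module Submission where

open import Defs hiding (sym)
open import Data.Nat using (ℕ; zero; suc; _+_; _*_; _⊓_; _≤_; _<_)
open import Data.Nat.Properties
  using (≤-trans; m⊓n≤m; m⊓n≤n; ⊓-sel; m≤m+n; m≤n+m; +-mono-≤; ≤-antisym; module ≤-Reasoning)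
open import Data.Bool using (true; T; if_then_else_)
open import Data.Unit using (tt)
open import Data.Fin using (Fin; zero; suc; _↑ˡ_; _↑ʳ_; remQuot)
open import Data.Fin.Properties using (splitAt-↑ˡ; splitAt-↑ʳ; injective⇒≤; *↔×)
open import Data.Fin.Subset using (Subset; _∈_; ∣_∣; ⊤; ⁅_⁆; inside; outside; Nonempty; Empty)
open import Data.Fin.Subset.Properties
  using (∣⊤∣≡n; ∈⊤; x∈⁅x⁆; x∈⁅y⁆⇒x≡y; ∣⁅x⁆∣≡1; p⊆q⇒∣p∣≤∣q∣; nonempty?)
open import Data.Vec using ([]; _∷_; _++_; here; there)
import Data.Vec as Vec
open import Data.Vec.Properties using (++-injective)
open import Data.List using (List; []; _∷_; map; filter; length; foldr; lookup)
import Data.List.Membership.Propositional as List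
open import Data.List.Membership.Propositional.Properties using (∈-++⁺ˡ; ∈-++⁺ʳ; ∈-map⁺; ∈-filter⁺)
open import Data.List.Relation.Unary.Any using (Any; index)
open import Data.List.Relation.Unary.Any.Properties using (lookup-index)
open import Data.Sum using (_⊎_; inj₁; inj₂)
open import Data.Product using (∃; _×_; _,_)
open import Function using (_∘_)
open import Function.Bundles using (Injection)
open import Function.Definitions using (Injective)
open import Function.Properties.Inverse using (↔⇒↣)
open import Relation.Binary.PropositionalEquality
  using (_≡_; refl; sym; trans; cong; cong₂; subst; module ≡-Reasoning)
open import Relation.Nullary using (yes; no; does; contradiction)
open import Relation.Unary using (Decidable)

allSubsets-complete : ∀ m (S : Subset m) → S List.∈ allSubsets m
allSubsets-complete zero    []            = Any.here refl
allSubsets-complete (suc m) (outside ∷ S) =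
  ∈-++⁺ˡ (∈-map⁺ (outside ∷_) (allSubsets-complete m S))
allSubsets-complete (suc m) (inside ∷ S)  =
  ∈-++⁺ʳ (map (outside ∷_) (allSubsets m)) (∈-map⁺ (inside ∷_) (allSubsets-complete m S))

module _ {A : Set} {P : A → Set} (P? : Decidable P) (f : A → ℕ) where

  minStep : A → ℕ → ℕ
  minStep x k = if does (P? x) then f x ⊓ k else k

  foldr-minStep-≤ : ∀ k xs {x} → x List.∈ xs → P x → foldr minStep k xs ≤ f x
  foldr-minStep-≤ k (y ∷ ys) (Any.here refl) py with P? y
  ... | yes _  = m⊓n≤m _ _
  ... | no ¬py = contradiction py ¬py
  foldr-minStep-≤ k (y ∷ ys) (Any.there x∈ys) px with P? y
  ... | yes _ = ≤-trans (m⊓n≤n _ _) (foldr-minStep-≤ k ys x∈ys px)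
  ... | no _  = foldr-minStep-≤ k ys x∈ys px

  foldr-minStep-attained : ∀ k xs →
    foldr minStep k xs ≡ k ⊎ ∃ λ x → P x × f x ≡ foldr minStep k xs
  foldr-minStep-attained k []       = inj₁ refl
  foldr-minStep-attained k (y ∷ ys) with P? y
  ... | no _ = foldr-minStep-attained k ys
  ... | yes py with ⊓-sel (f y) (foldr minStep k ys)
  ...   | inj₁ eq = inj₂ (y , py , sym eq)
  ...   | inj₂ eq rewrite eq = foldr-minStep-attained k ys

module _ (G : Graph) where

  ⊤-dominating : Dominating G ⊤
  ⊤-dominating v v∉⊤ = contradiction ∈⊤ v∉⊤

  γ-minimal : ∀ S → Dominating G S → γ G ≤ ∣ S ∣
  γ-minimal S =
    foldr-minStep-≤ (Dominating? G) ∣_∣ (n G) (allSubsets (n G)) (allSubsets-complete (n G) S)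

  γ-attained : ∃ (IsγSet G)
  γ-attained with foldr-minStep-attained (Dominating? G) ∣_∣ (n G) (allSubsets (n G))
  ... | inj₁ γ≡n = ⊤ , ⊤-dominating , trans (∣⊤∣≡n (n G)) (sym γ≡n)
  ... | inj₂ γ-set = γ-set

∣p++q∣≡∣p∣+∣q∣ : ∀ {m k} (p : Subset m) (q : Subset k) → ∣ p ++ q ∣ ≡ ∣ p ∣ + ∣ q ∣
∣p++q∣≡∣p∣+∣q∣ []            q = refl
∣p++q∣≡∣p∣+∣q∣ (inside ∷ p)  q = cong suc (∣p++q∣≡∣p∣+∣q∣ p q)
∣p++q∣≡∣p∣+∣q∣ (outside ∷ p) q = ∣p++q∣≡∣p∣+∣q∣ p q

↑ˡ-∈-++⁺ : ∀ {m k} {x} (p : Subset m) (q : Subset k) → x ∈ p → (x ↑ˡ k) ∈ (p ++ q)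
↑ˡ-∈-++⁺ (_ ∷ p) q here        = here
↑ˡ-∈-++⁺ (_ ∷ p) q (there x∈p) = there (↑ˡ-∈-++⁺ p q x∈p)

↑ˡ-∈-++⁻ : ∀ {m k} {x} (p : Subset m) (q : Subset k) → (x ↑ˡ k) ∈ (p ++ q) → x ∈ p
↑ˡ-∈-++⁻ {x = zero}  (_ ∷ p) q here       = here
↑ˡ-∈-++⁻ {x = suc x} (_ ∷ p) q (there x∈) = there (↑ˡ-∈-++⁻ p q x∈)

↑ʳ-∈-++⁺ : ∀ {m k} {y} (p : Subset m) (q : Subset k) → y ∈ q → (m ↑ʳ y) ∈ (p ++ q)
↑ʳ-∈-++⁺ []      q y∈q = y∈q
↑ʳ-∈-++⁺ (_ ∷ p) q y∈q = there (↑ʳ-∈-++⁺ p q y∈q)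

↑ʳ-∈-++⁻ : ∀ {m k} {y} (p : Subset m) (q : Subset k) → (m ↑ʳ y) ∈ (p ++ q) → y ∈ q
↑ʳ-∈-++⁻ []      q y∈         = y∈
↑ʳ-∈-++⁻ (_ ∷ p) q (there y∈) = ↑ʳ-∈-++⁻ p q y∈

⁅⁆-injective : ∀ {m} {x y : Fin m} → ⁅ x ⁆ ≡ ⁅ y ⁆ → x ≡ y
⁅⁆-injective {x = x} {y} eq = x∈⁅y⁆⇒x≡y y (subst (x ∈_) eq (x∈⁅x⁆ x))

pairSet : ∀ {m k} → Fin m × Fin k → Subset (m + k)
pairSet (a , b) = ⁅ a ⁆ ++ ⁅ b ⁆

pairSet-injective : ∀ {m k} → Injective _≡_ _≡_ (pairSet {m} {k})
pairSet-injective {x = a , b} {a′ , b′} eq with ++-injective ⁅ a ⁆ ⁅ a′ ⁆ eq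
... | a≡a′ , b≡b′ = cong₂ _,_ (⁅⁆-injective a≡a′) (⁅⁆-injective b≡b′)

∣pairSet∣≡2 : ∀ {m k} (ab : Fin m × Fin k) → ∣ pairSet ab ∣ ≡ 2
∣pairSet∣≡2 (a , b) = trans (∣p++q∣≡∣p∣+∣q∣ ⁅ a ⁆ ⁅ b ⁆) (cong₂ _+_ (∣⁅x⁆∣≡1 a) (∣⁅x⁆∣≡1 b))

Nonempty⇒0<∣p∣ : ∀ {m} {p : Subset m} → Nonempty p → 0 < ∣ p ∣
Nonempty⇒0<∣p∣ {p = p} (x , x∈p) = subst (_≤ ∣ p ∣) (∣⁅x⁆∣≡1 x) (p⊆q⇒∣p∣≤∣q∣ ⁅x⁆⊆p)
  where
  ⁅x⁆⊆p : ∀ {y} → y ∈ ⁅ x ⁆ → y ∈ p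
  ⁅x⁆⊆p y∈⁅x⁆ = subst (_∈ p) (sym (x∈⁅y⁆⇒x≡y x y∈⁅x⁆)) x∈p

∈-injective⇒≤length : ∀ {m} {A : Set} {xs : List A} (f : Fin m → A) →
  Injective _≡_ _≡_ f → (∀ i → f i List.∈ xs) → m ≤ length xs
∈-injective⇒≤length {xs = xs} f f-injective f∈xs = injective⇒≤ index-injective
  where
  open ≡-Reasoning
  index-injective : Injective _≡_ _≡_ (index ∘ f∈xs)
  index-injective {i} {j} eq = f-injective (begin
    f i                        ≡⟨ lookup-index (f∈xs i) ⟩
    lookup xs (index (f∈xs i)) ≡⟨ cong (lookup xs) eq ⟩
    lookup xs (index (f∈xs j)) ≡⟨ sym (lookup-index (f∈xs j)) ⟩
    f j                        ∎)

data SplitAtView (m k : ℕ) : Fin (m + k) → Set where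
  inˡ : (i : Fin m) → SplitAtView m k (i ↑ˡ k)
  inʳ : (j : Fin k) → SplitAtView m k (m ↑ʳ j)

splitAtView : ∀ m {k} (i : Fin (m + k)) → SplitAtView m k i
splitAtView zero    i       = inʳ i
splitAtView (suc m) zero    = inˡ zero
splitAtView (suc m) (suc i) with splitAtView m i
... | inˡ i′ = inˡ (suc i′)
... | inʳ j  = inʳ j

module _ (G₁ G₂ : Graph) where

  private
    n₁ = n G₁
    n₂ = n G₂

  ∨-adjˡˡ : ∀ a b → adj (G₁ ∨ᴳ G₂) (a ↑ˡ n₂) (b ↑ˡ n₂) ≡ adj G₁ a b
  ∨-adjˡˡ a b rewrite splitAt-↑ˡ n₁ a n₂ | splitAt-↑ˡ n₁ b n₂ = refl

  ∨-adjʳʳ : ∀ a b → adj (G₁ ∨ᴳ G₂) (n₁ ↑ʳ a) (n₁ ↑ʳ b) ≡ adj G₂ a b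
  ∨-adjʳʳ a b rewrite splitAt-↑ʳ n₁ n₂ a | splitAt-↑ʳ n₁ n₂ b = refl

  ∨-adjˡʳ : ∀ a b → adj (G₁ ∨ᴳ G₂) (a ↑ˡ n₂) (n₁ ↑ʳ b) ≡ true
  ∨-adjˡʳ a b rewrite splitAt-↑ˡ n₁ a n₂ | splitAt-↑ʳ n₁ n₂ b = refl

  ∨-adjʳˡ : ∀ a b → adj (G₁ ∨ᴳ G₂) (n₁ ↑ʳ a) (b ↑ˡ n₂) ≡ true
  ∨-adjʳˡ a b rewrite splitAt-↑ʳ n₁ n₂ a | splitAt-↑ˡ n₁ b n₂ = refl

  ∨-dominating-restrictˡ : (p : Subset n₁) (q : Subset n₂) → Empty q →
    Dominating (G₁ ∨ᴳ G₂) (p ++ q) → Dominating G₁ p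
  ∨-dominating-restrictˡ p q q-empty dom v v∉p
    with dom (v ↑ˡ n₂) (v∉p ∘ ↑ˡ-∈-++⁻ p q)
  ... | u , u∈ , vu with splitAtView n₁ u
  ... | inˡ a = a , ↑ˡ-∈-++⁻ p q u∈ , subst T (∨-adjˡˡ v a) vu
  ... | inʳ b = contradiction (b , ↑ʳ-∈-++⁻ p q u∈) q-empty

  ∨-dominating-restrictʳ : (p : Subset n₁) (q : Subset n₂) → Empty p →
    Dominating (G₁ ∨ᴳ G₂) (p ++ q) → Dominating G₂ q
  ∨-dominating-restrictʳ p q p-empty dom v v∉q
    with dom (n₁ ↑ʳ v) (v∉q ∘ ↑ʳ-∈-++⁻ p q)
  ... | u , u∈ , vu with splitAtView n₁ u
  ... | inˡ a = contradiction (a , ↑ˡ-∈-++⁻ p q u∈) p-empty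
  ... | inʳ b = b , ↑ʳ-∈-++⁻ p q u∈ , subst T (∨-adjʳʳ v b) vu

  ∨-dominating-pairSet : ∀ ab → Dominating (G₁ ∨ᴳ G₂) (pairSet ab)
  ∨-dominating-pairSet (a , b) v _ with splitAtView n₁ v
  ... | inˡ v′ = n₁ ↑ʳ b , ↑ʳ-∈-++⁺ ⁅ a ⁆ ⁅ b ⁆ (x∈⁅x⁆ b) , subst T (sym (∨-adjˡʳ v′ b)) tt
  ... | inʳ v′ = a ↑ˡ n₂ , ↑ˡ-∈-++⁺ ⁅ a ⁆ ⁅ b ⁆ (x∈⁅x⁆ a) , subst T (sym (∨-adjʳˡ v′ a)) tt

  module _ (2≤γ₁ : 2 ≤ γ G₁) (2≤γ₂ : 2 ≤ γ G₂) where

    ∨-dominating⇒2≤∣p∣+∣q∣ : (p : Subset n₁) (q : Subset n₂) →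
      Dominating (G₁ ∨ᴳ G₂) (p ++ q) → 2 ≤ ∣ p ∣ + ∣ q ∣
    ∨-dominating⇒2≤∣p∣+∣q∣ p q dom with nonempty? p | nonempty? q
    ... | _          | no q-empty = ≤-trans 2≤γ₁
      (≤-trans (γ-minimal G₁ p (∨-dominating-restrictˡ p q q-empty dom)) (m≤m+n _ _))
    ... | no p-empty | _          = ≤-trans 2≤γ₂
      (≤-trans (γ-minimal G₂ q (∨-dominating-restrictʳ p q p-empty dom)) (m≤n+m _ _))
    ... | yes p≢∅    | yes q≢∅    = +-mono-≤ (Nonempty⇒0<∣p∣ p≢∅) (Nonempty⇒0<∣p∣ q≢∅)

    2≤γ-∨ : 2 ≤ γ (G₁ ∨ᴳ G₂)
    2≤γ-∨ with γ-attained (G₁ ∨ᴳ G₂)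
    ... | S , dom , ∣S∣≡γ with Vec.splitAt n₁ S
    ... | p , q , refl = begin
      2                 ≤⟨ ∨-dominating⇒2≤∣p∣+∣q∣ p q dom ⟩
      ∣ p ∣ + ∣ q ∣     ≡⟨ sym (∣p++q∣≡∣p∣+∣q∣ p q) ⟩
      ∣ p ++ q ∣        ≡⟨ ∣S∣≡γ ⟩
      γ (G₁ ∨ᴳ G₂)      ∎
      where open ≤-Reasoning

    ∨-γSet-pairSet : ∀ ab → IsγSet (G₁ ∨ᴳ G₂) (pairSet ab)
    ∨-γSet-pairSet ab = dom , ≤-antisym ∣pairSet∣≤γ (γ-minimal (G₁ ∨ᴳ G₂) (pairSet ab) dom)
      where
      dom : Dominating (G₁ ∨ᴳ G₂) (pairSet ab)
      dom = ∨-dominating-pairSet ab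
      ∣pairSet∣≤γ : ∣ pairSet ab ∣ ≤ γ (G₁ ∨ᴳ G₂)
      ∣pairSet∣≤γ = subst (_≤ γ (G₁ ∨ᴳ G₂)) (sym (∣pairSet∣≡2 ab)) 2≤γ-∨

theorem3p2 : (G₁ G₂ : Graph) → Connected G₁ → Connected G₂ →
    2 ≤ γ G₁ → γ G₁ ≤ γ G₂ →
    order G₁ * order G₂ ≤ ζ (G₁ ∨ᴳ G₂)
theorem3p2 G₁ G₂ _ _ 2≤γ₁ γ₁≤γ₂ =
  ∈-injective⇒≤length (pairSet ∘ remQuot {n G₁} (n G₂))
    (Injection.injective (↔⇒↣ (*↔× {n G₁} {n G₂})) ∘ pairSet-injective)
    (λ i → ∈-filter⁺ (IsγSet? (G₁ ∨ᴳ G₂)) (allSubsets-complete _ _) (γSet (remQuot (n G₂) i)))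
  where
  γSet : ∀ ab → IsγSet (G₁ ∨ᴳ G₂) (pairSet ab)
  γSet = ∨-γSet-pairSet G₁ G₂ 2≤γ₁ (≤-trans 2≤γ₁ γ₁≤γ₂)
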